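{- Let $\mathcal{P}$ and $\mathcal{Q}$ be weight-equitable partitions of the vertex set of a connected simple undirected graph $G$. Then the join $\mathcal{P}\vee\mathcal{Q}$ is a weight-equitable partition of $G$.
   Context: Let $\nu$ be the Perron eigenvector of $G$ (positive eigenvector of the adjacency matrix for the largest eigenvalue, minimum entry $1$). A partition $\{V_1,\dots,V_m\}$ of $V(G)$ is weight-equitable if for all $i,j$ the quantity $b^*_{ij}(u)=\frac{1}{\nu_u}\sum_{v\in V_j,\,v\sim u}\nu_v$ is the same for all $u\in V_i$. The join $\mathcal{P}\vee\mathcal{Q}$ is the partition of $V(G)$ into the connected components of the auxiliary graph on $V(G)$ in which $u,v$ are adjacent whenever they lie in a common cell of $\mathcal{P}$ or of $\mathcal{Q}$. -}

module Defs where

open import Level using (Level; _⊔_) renaming (suc to lsuc)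
open import Data.Nat using (ℕ; zero; suc; _≡ᵇ_)
open import Data.Fin using (Fin)
import Data.Fin
open import Data.Bool using (Bool; true; false; _∧_; if_then_else_)
open import Data.Sum using (_⊎_)
open import Data.Product using (Σ; ∃; _×_; _,_)
open import Relation.Nullary using (¬_)
open import Relation.Binary.PropositionalEquality using (_≡_)
open import Algebra.Bundles using (CommutativeRing)

-- Ordered fields (the reals ℝ are one instance).  Inverse is a total
-- operation whose defining law only holds for non-zero arguments.

record OrderedField (c ℓ₁ ℓ₂ : Level) : Set (lsuc (c ⊔ ℓ₁ ⊔ ℓ₂)) where
  field
    commutativeRing : CommutativeRing c ℓ₁
  open CommutativeRing commutativeRing public
  field
    _⁻¹      : Carrier → Carrier
    ⁻¹-inverse : ∀ x → ¬ (x ≈ 0#) → (x * (x ⁻¹)) ≈ 1#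
    0≉1      : ¬ (0# ≈ 1#)
    _<_      : Carrier → Carrier → Set ℓ₂
    <-irrefl : ∀ {x y} → x ≈ y → ¬ (x < y)
    <-trans  : ∀ {x y z} → x < y → y < z → x < z
    <-resp-≈ : ∀ {x x' y y'} → x ≈ x' → y ≈ y' → x < y → x' < y'
    <-trichotomous : ∀ x y → (x < y) ⊎ ((x ≈ y) ⊎ (y < x))
    +-mono-< : ∀ {x y} z → x < y → (x + z) < (y + z)
    *-pos    : ∀ {x y} → 0# < x → 0# < y → 0# < (x * y)

  _≤_ : Carrier → Carrier → Set (ℓ₁ ⊔ ℓ₂)
  x ≤ y = (x < y) ⊎ (x ≈ y)

record SimpleGraph (n : ℕ) : Set where
  field
    adj     : Fin n → Fin n → Bool
    adj-sym : ∀ u v → adj u v ≡ adj v u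
    loopless : ∀ u → adj u u ≡ false

module _ {n : ℕ} (G : SimpleGraph n) where
  open SimpleGraph G

  data Walk : Fin n → Fin n → Set where
    nil  : ∀ {u} → Walk u u
    cons : ∀ {u v w} → adj u v ≡ true → Walk v w → Walk u w

  Connected : Set
  Connected = ∀ u v → Walk u v

module _ {c ℓ : Level} (F : CommutativeRing c ℓ) where
  open CommutativeRing F

  sumFin : (n : ℕ) → (Fin n → Carrier) → Carrier
  sumFin zero    f = 0#
  sumFin (suc n) f = f Data.Fin.zero + sumFin n (λ i → f (Data.Fin.suc i))

module _ {c ℓ₁ ℓ₂ : Level} (F : OrderedField c ℓ₁ ℓ₂) {n : ℕ}
         (G : SimpleGraph n) where
  open OrderedField F
  open SimpleGraph G

  adjMul : (Fin n → Carrier) → Fin n → Carrier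
  adjMul x u = sumFin commutativeRing n (λ v → if adj u v then x v else 0#)

  IsEigenpair : Carrier → (Fin n → Carrier) → Set ℓ₁
  IsEigenpair μ x = (¬ (∀ u → x u ≈ 0#)) × (∀ u → adjMul x u ≈ (μ * x u))

  IsPerronVector : (Fin n → Carrier) → Set (c ⊔ ℓ₁ ⊔ ℓ₂)
  IsPerronVector ν =
    Σ Carrier λ λ₁ →
      IsEigenpair λ₁ ν
      × (∀ μ x → IsEigenpair μ x → μ ≤ λ₁)
      × (∀ u → 0# < ν u)
      × (∀ u → 1# ≤ ν u)
      × (∃ λ u → ν u ≈ 1#)

  -- A partition of Fin n is given by a labelling; its cells are the
  -- (nonempty) fibres.  b*_{ij}(u) with V_j the cell of w:
  bstar : (Fin n → Carrier) → (Fin n → ℕ) → Fin n → Fin n → Carrier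
  bstar ν p u w =
    (ν u ⁻¹) * sumFin commutativeRing n
                 (λ v → if adj u v ∧ (p v ≡ᵇ p w) then ν v else 0#)

  WeightEquitable : (Fin n → Carrier) → (Fin n → ℕ) → Set ℓ₁
  WeightEquitable ν p =
    ∀ u u' → p u ≡ p u' → ∀ w → bstar ν p u w ≈ bstar ν p u' w

-- The join P ∨ Q: connected components of the auxiliary graph in which
-- u, v are adjacent iff they share a cell of P or of Q.

module _ {n : ℕ} (p q : Fin n → ℕ) where
  data JoinPath : Fin n → Fin n → Set where
    here  : ∀ {u} → JoinPath u u
    stepP : ∀ {u v w} → p u ≡ p v → JoinPath v w → JoinPath u w
    stepQ : ∀ {u v w} → q u ≡ q v → JoinPath v w → JoinPath u w

{-# OPTIONS --safe #-}
-- Extend b* to arbitrary target sets A: b*_A(u) = ν_u⁻¹ Σ_{v ∈ A, v ∼ u} ν_v.  It is additive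
-- over disjoint unions, and every union of P-cells is built from cells by disjoint unions, so
-- a weight-equitable P makes b*_A constant on P-cells for every such A.  If P refines J, each
-- J-cell is such a union, so b* into J-cells is constant along P-steps, and likewise along
-- Q-steps; the join is reached by chains of these steps.
module Submission where

open import Defs
open import Level using (Level)
open import Algebra.Bundles using (CommutativeRing)
open import Data.Bool using (Bool; true; false; T; T?; not; _∧_; _∨_; if_then_else_)
open import Data.Bool.Properties using (T-∧; T-≡; ∧-identityʳ; ∧-zeroʳ)
open import Data.Empty using (⊥; ⊥-elim)
open import Data.Fin using (Fin; toℕ; fromℕ<)
import Data.Fin as Fin
open import Data.Fin.Properties using (toℕ-injective; toℕ-fromℕ<; toℕ<n)
open import Data.Nat using (ℕ; zero; suc; _≡ᵇ_; _≤_; _<_; s≤s⁻¹)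
open import Data.Nat.Properties using (≡ᵇ⇒≡; ≡⇒≡ᵇ; ≤∧≢⇒<; <⇒≤; n≮0; ≤-refl)
open import Data.Product using (_,_; proj₂)
open import Data.Unit using (tt)
open import Function using (_∘_)
open import Function.Bundles using (_⇔_; Equivalence)
open import Relation.Binary.Bundles using (Setoid)
open import Relation.Binary.PropositionalEquality as ≡
  using (_≡_; _≢_; refl; cong; cong₂; subst)
open import Relation.Nullary using (¬_; yes; no)
import Relation.Binary.Reasoning.Setoid as SetoidReasoning
import Algebra.Properties.Semiring.Sum as Sum

private
  variable
    ℓ : Level
    n : ℕ

false-unless : ∀ {b} → ¬ T b → b ≡ false
false-unless {false} _ = refl
false-unless {true} ¬b = ⊥-elim (¬b tt)

T-not : ∀ {b} → T (not b) → ¬ T b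
T-not {false} _ ()

<-fromℕ< : ∀ {k} (k<n : k < n) v → toℕ v < suc k → v ≢ fromℕ< k<n → toℕ v < k
<-fromℕ< k<n v v<1+k v≢k =
  ≤∧≢⇒< (s≤s⁻¹ v<1+k) (λ e → v≢k (toℕ-injective (≡.trans e (≡.sym (toℕ-fromℕ< k<n)))))

Disjoint : (A B : Fin n → Bool) → Set
Disjoint A B = ∀ v → T (A v) → T (B v) → ⊥

module _ (p : Fin n → ℕ) where

  cell : Fin n → Fin n → Bool
  cell x v = p v ≡ᵇ p x

  Saturated : (Fin n → Bool) → Set
  Saturated A = ∀ a b → p a ≡ p b → A a ≡ A b

  cell-saturated : ∀ x → Saturated (cell x)
  cell-saturated x a b e = cong (_≡ᵇ p x) e

  cell-refl : ∀ x → T (cell x x)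
  cell-refl x = ≡⇒≡ᵇ (p x) (p x) refl

  saturated-ind : (Φ : (Fin n → Bool) → Set ℓ) →
    (∀ {A B} → (∀ v → A v ≡ B v) → Φ A → Φ B) →
    Φ (λ _ → false) →
    (∀ x {A} → Disjoint (cell x) A → Φ A → Φ (λ v → cell x v ∨ A v)) →
    ∀ A → Saturated A → Φ A
  saturated-ind Φ Φ-resp Φ-∅ Φ-cell-∪ A sat = go _ ≤-refl A sat (λ v _ → toℕ<n v)
    where
    Below : ℕ → (Fin n → Bool) → Set
    Below k A = ∀ v → T (A v) → toℕ v < k

    -- Peel off the cell of the largest vertex that A may still contain.
    go : ∀ k → k ≤ n → ∀ A → Saturated A → Below k A → Φ A
    go zero _ A _ below = Φ-resp (λ v → ≡.sym (false-unless (n≮0 ∘ below v))) Φ-∅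
    go (suc k) k<n A sat below with T? (A (fromℕ< k<n))
    ... | no ¬Ax = go k (<⇒≤ k<n) A sat
                     (λ v Av → <-fromℕ< k<n v (below v Av) (λ v≡x → ¬Ax (subst (T ∘ A) v≡x Av)))
    ... | yes Ax = Φ-resp A-split (Φ-cell-∪ x disjoint (go k (<⇒≤ k<n) B B-saturated B-below))
      where
      x : Fin n
      x = fromℕ< k<n
      B : Fin n → Bool
      B v = A v ∧ not (cell x v)
      B-saturated : Saturated B
      B-saturated a b e = cong₂ _∧_ (sat a b e) (cong not (cell-saturated x a b e))
      disjoint : Disjoint (cell x) B
      disjoint v xv Bv = T-not (proj₂ (Equivalence.to T-∧ Bv)) xv
      B-below : Below k B
      B-below v Bv =
        let (Av , ¬xv) = Equivalence.to T-∧ Bv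
        in <-fromℕ< k<n v (below v Av)
             (λ v≡x → T-not ¬xv (subst (T ∘ cell x) (≡.sym v≡x) (cell-refl x)))
      A-split : ∀ v → cell x v ∨ B v ≡ A v
      A-split v with p v ≡ᵇ p x in e
      ... | true  = ≡.trans (≡.sym (Equivalence.to T-≡ Ax))
                          (sat x v (≡.sym (≡ᵇ⇒≡ (p v) (p x) (Equivalence.from T-≡ e))))
      ... | false = ∧-identityʳ (A v)

sumFin≡sum : ∀ {c ℓ} (R : CommutativeRing c ℓ) m (f : Fin m → CommutativeRing.Carrier R) →
  sumFin R m f ≡ Sum.sum (CommutativeRing.semiring R) f
sumFin≡sum R zero    f = refl
sumFin≡sum R (suc m) f = cong (f Fin.zero +_) (sumFin≡sum R m (f ∘ Fin.suc))
  where open CommutativeRing R using (_+_)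

Refines : (p j : Fin n → ℕ) → Set
Refines p j = ∀ a b → p a ≡ p b → j a ≡ j b

module _ {c ℓ₁ ℓ₂} (F : OrderedField c ℓ₁ ℓ₂) {n : ℕ} (G : SimpleGraph n)
         (ν : Fin n → OrderedField.Carrier F) where
  open OrderedField F
  open SimpleGraph G
  open Sum semiring using (sum; sum-cong-≋; sum-cong-≗; ∑-distrib-+; sum-replicate-zero)
  open SetoidReasoning setoid

  neighbourWeight : (Fin n → Bool) → Fin n → Fin n → Carrier
  neighbourWeight A u v = if adj u v ∧ A v then ν v else 0#

  -- bstar F G ν p u w unfolds to bstarOn (cell p w) u.
  bstarOn : (Fin n → Bool) → Fin n → Carrier
  bstarOn A u = ν u ⁻¹ * sumFin commutativeRing n (neighbourWeight A u)

  private
    nbrSum : (Fin n → Bool) → Fin n → Carrier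
    nbrSum A u = sum (neighbourWeight A u)

    bstarOn≈ : ∀ A u → bstarOn A u ≈ ν u ⁻¹ * nbrSum A u
    bstarOn≈ A u = reflexive (cong (ν u ⁻¹ *_) (sumFin≡sum commutativeRing n _))

    select-∨ : ∀ a b c x → (T b → T c → ⊥) →
      (if a ∧ (b ∨ c) then x else 0#) ≈ (if a ∧ b then x else 0#) + (if a ∧ c then x else 0#)
    select-∨ false b     c     x _ = sym (+-identityˡ 0#)
    select-∨ true  true  true  x disj = ⊥-elim (disj tt tt)
    select-∨ true  true  false x _ = sym (+-identityʳ x)
    select-∨ true  false true  x _ = sym (+-identityˡ x)
    select-∨ true  false false x _ = sym (+-identityˡ 0#)

  bstarOn-resp : ∀ {A B} → (∀ v → A v ≡ B v) → ∀ u → bstarOn A u ≈ bstarOn B u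
  bstarOn-resp A≗B u = begin
    bstarOn _ u          ≈⟨ bstarOn≈ _ u ⟩
    ν u ⁻¹ * nbrSum _ u  ≡⟨ cong (ν u ⁻¹ *_) (sum-cong-≗ λ v →
                              cong (λ b → if adj u v ∧ b then ν v else 0#) (A≗B v)) ⟩
    ν u ⁻¹ * nbrSum _ u  ≈⟨ bstarOn≈ _ u ⟨
    bstarOn _ u          ∎

  bstarOn-∅ : ∀ u → bstarOn (λ _ → false) u ≈ 0#
  bstarOn-∅ u = begin
    bstarOn _ u                  ≈⟨ bstarOn≈ _ u ⟩
    ν u ⁻¹ * nbrSum _ u          ≈⟨ *-congˡ (sum-cong-≋ λ v →
                                      reflexive (cong (if_then ν v else 0#) (∧-zeroʳ (adj u v)))) ⟩
    ν u ⁻¹ * sum {n} (λ _ → 0#)  ≈⟨ *-congˡ (sum-replicate-zero n) ⟩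
    ν u ⁻¹ * 0#                  ≈⟨ zeroʳ _ ⟩
    0#                           ∎

  bstarOn-∪ : ∀ {A B} → Disjoint A B → ∀ u →
    bstarOn (λ v → A v ∨ B v) u ≈ bstarOn A u + bstarOn B u
  bstarOn-∪ {A} {B} disj u = begin
    bstarOn _ u                                ≈⟨ bstarOn≈ _ u ⟩
    ν u ⁻¹ * nbrSum _ u                        ≈⟨ *-congˡ (sum-cong-≋ λ v →
                                                    select-∨ (adj u v) (A v) (B v) (ν v) (disj v)) ⟩
    ν u ⁻¹ * sum (λ v → neighbourWeight A u v + neighbourWeight B u v)
                                               ≈⟨ *-congˡ (∑-distrib-+ (neighbourWeight A u) (neighbourWeight B u)) ⟩
    ν u ⁻¹ * (nbrSum A u + nbrSum B u)         ≈⟨ distribˡ _ _ _ ⟩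
    ν u ⁻¹ * nbrSum A u + ν u ⁻¹ * nbrSum B u  ≈⟨ +-cong (bstarOn≈ A u) (bstarOn≈ B u) ⟨
    bstarOn A u + bstarOn B u                  ∎

  bstarOn-constant-on-cells : ∀ {p} → WeightEquitable F G ν p → ∀ {A} → Saturated p A →
    ∀ {u u'} → p u ≡ p u' → bstarOn A u ≈ bstarOn A u'
  bstarOn-constant-on-cells {p} wp {A} sat {u} {u'} pu≡pu' =
    saturated-ind p (λ A → bstarOn A u ≈ bstarOn A u') resp
      (trans (bstarOn-∅ u) (sym (bstarOn-∅ u'))) add-cell A sat
    where
    resp : ∀ {A B} → (∀ v → A v ≡ B v) → bstarOn A u ≈ bstarOn A u' → bstarOn B u ≈ bstarOn B u'
    resp A≗B eq = trans (sym (bstarOn-resp A≗B u)) (trans eq (bstarOn-resp A≗B u'))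
    add-cell : ∀ x {A} → Disjoint (cell p x) A → bstarOn A u ≈ bstarOn A u' →
      bstarOn (λ v → cell p x v ∨ A v) u ≈ bstarOn (λ v → cell p x v ∨ A v) u'
    add-cell x {A} disj eq = begin
      bstarOn _ u                                ≈⟨ bstarOn-∪ disj u ⟩
      bstarOn (cell p x) u + bstarOn A u         ≈⟨ +-cong (wp u u' pu≡pu' x) eq ⟩
      bstarOn (cell p x) u' + bstarOn A u'       ≈⟨ bstarOn-∪ disj u' ⟨
      bstarOn _ u'                               ∎

  bstar-constant-on-finer-cells : ∀ {p j} → WeightEquitable F G ν p → Refines p j →
    ∀ u u' → p u ≡ p u' → ∀ w → bstar F G ν j u w ≈ bstar F G ν j u' w
  bstar-constant-on-finer-cells {j = j} wp p⊑j u u' pu≡pu' w =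
    bstarOn-constant-on-cells wp (λ a b e → cong (_≡ᵇ j w) (p⊑j a b e)) pu≡pu'

joinPath-invariant : ∀ {c ℓ} (S : Setoid c ℓ) (f : Fin n → Setoid.Carrier S) {p q} →
  (∀ a b → p a ≡ p b → Setoid._≈_ S (f a) (f b)) →
  (∀ a b → q a ≡ q b → Setoid._≈_ S (f a) (f b)) →
  ∀ {u v} → JoinPath p q u v → Setoid._≈_ S (f u) (f v)
joinPath-invariant S f fp fq here = Setoid.refl S
joinPath-invariant S f fp fq (stepP e path) =
  Setoid.trans S (fp _ _ e) (joinPath-invariant S f fp fq path)
joinPath-invariant S f fp fq (stepQ e path) =
  Setoid.trans S (fq _ _ e) (joinPath-invariant S f fp fq path)

corollary4p8 : ∀ {c ℓ₁ ℓ₂ : Level} (F : OrderedField c ℓ₁ ℓ₂) {n : ℕ}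
    (G : SimpleGraph n) → Connected G →
    (ν : Fin n → OrderedField.Carrier F) → IsPerronVector F G ν →
    (p q : Fin n → ℕ) →
    WeightEquitable F G ν p → WeightEquitable F G ν q →
    (j : Fin n → ℕ) → (∀ u v → (j u ≡ j v) ⇔ JoinPath p q u v) →
    WeightEquitable F G ν j
corollary4p8 F G _ ν _ p q wp wq j j⇔join u u' ju≡ju' w =
  joinPath-invariant (OrderedField.setoid F) (λ x → bstar F G ν j x w)
    (λ a b e → bstar-constant-on-finer-cells F G ν wp p⊑j a b e w)
    (λ a b e → bstar-constant-on-finer-cells F G ν wq q⊑j a b e w)
    (Equivalence.to (j⇔join u u') ju≡ju')
  where
  p⊑j : Refines p j
  p⊑j a b e = Equivalence.from (j⇔join a b) (stepP e here)
  q⊑j : Refines q j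
  q⊑j a b e = Equivalence.from (j⇔join a b) (stepQ e here)
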